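{- Let $C$ be a completely regular code in $H(m,q)$ with distance partition $\{C,C_1,\ldots,C_\rho\}$. Then $C_\rho$ is completely regular with distance partition $\{C_\rho,C_{\rho-1},\ldots,C_1,C\}$, and $\mathrm{Aut}(C)=\mathrm{Aut}(C_\rho)$. Furthermore, for any group $X$ of automorphisms of $H(m,q)$, $C$ is $X$-completely transitive if and only if $C_\rho$ is $X$-completely transitive.
   Context: $H(m,q)$ is the Hamming graph on $Q^m$ with Hamming distance. A code is a subset $C$ of vertices; $\mathrm{Aut}(C)$ is its setwise stabiliser in $\mathrm{Aut}(H(m,q))$. $C_i$ is the set of vertices at distance exactly $i$ from $C$ (distance to the nearest codeword), $\rho$ the covering radius (maximal such distance), and $\{C,C_1,\ldots,C_\rho\}$ the distance partition. $C$ is completely regular if for every $i\in\{0,\ldots,\rho\}$, every $\gamma\in C_i$ and every $k\in\{0,\ldots,m\}$, the number of codewords at distance $k$ from $\gamma$ depends only on $i$ and $k$. $C$ is $X$-completely transitive if every $C_i$, $i=0,\ldots,\rho$, is an $X$-orbit. -}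

module Defs where

open import Data.Nat using (ℕ; zero; suc; _≤_; _⊔_; _⊓_; _≡ᵇ_)
open import Data.Bool using (Bool; true; false)
open import Data.Fin using (Fin)
open import Data.Fin.Properties using (_≟_)
open import Data.Vec using (Vec; []; _∷_)
open import Data.List using (List; []; _∷_; map; concatMap; allFin; filterᵇ; length; foldr)
open import Data.Product using (Σ; ∃; _×_; _,_)
open import Function using (_∘_; _⇔_)
open import Relation.Nullary.Decidable using (⌊_⌋)
open import Relation.Binary.PropositionalEquality using (_≡_)

Word : ℕ → ℕ → Set
Word m q = Vec (Fin q) m

hd : ∀ {m q} → Word m q → Word m q → ℕ
hd []       []       = 0
hd (a ∷ xs) (b ∷ ys) with ⌊ a ≟ b ⌋
... | true  = hd xs ys
... | false = suc (hd xs ys)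

words : ∀ m q → List (Word m q)
words zero    q = [] ∷ []
words (suc m) q = concatMap (λ a → map (a ∷_) (words m q)) (allFin q)

Code : ℕ → ℕ → Set
Code m q = Word m q → Bool

_∈C_ : ∀ {m q} → Word m q → Code m q → Set
x ∈C C = C x ≡ true

NonEmpty : ∀ {m q} → Code m q → Set
NonEmpty C = ∃ λ x → x ∈C C

codewords : ∀ {m q} → Code m q → List (Word m q)
codewords {m} {q} C = filterᵇ C (words m q)

-- minimum of a list (default value for the empty list; only used for nonempty codes)
minList : ℕ → List ℕ → ℕ
minList d []       = d
minList d (x ∷ xs) = foldr _⊓_ x xs

dist : ∀ {m q} → Word m q → Code m q → ℕ
dist {m} γ C = minList m (map (hd γ) (codewords C))

coveringRadius : ∀ {m q} → Code m q → ℕ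
coveringRadius {m} {q} C = foldr _⊔_ 0 (map (λ γ → dist γ C) (words m q))

layer : ∀ {m q} → Code m q → ℕ → Code m q
layer C i γ = dist γ C ≡ᵇ i

countAt : ∀ {m q} → Code m q → Word m q → ℕ → ℕ
countAt C γ k = length (filterᵇ (λ c → hd γ c ≡ᵇ k) (codewords C))

CompletelyRegular : ∀ {m q} → Code m q → Set
CompletelyRegular {m} C =
  ∀ i → i ≤ coveringRadius C →
  ∀ γ γ' → γ ∈C layer C i → γ' ∈C layer C i →
  ∀ k → k ≤ m → countAt C γ k ≡ countAt C γ' k

Adj : ∀ {m q} → Word m q → Word m q → Set
Adj x y = hd x y ≡ 1

record Aut (m q : ℕ) : Set where
  field
    fun     : Word m q → Word m q
    inv     : Word m q → Word m q
    invˡ    : ∀ x → inv (fun x) ≡ x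
    invʳ    : ∀ x → fun (inv x) ≡ x
    adjPres : ∀ x y → Adj x y ⇔ Adj (fun x) (fun y)
open Aut public

Stabilises : ∀ {m q} → Aut m q → Code m q → Set
Stabilises {m} {q} g C = ∀ (x : Word m q) → C (fun g x) ≡ C x

idAut : ∀ {m q} → Aut m q
idAut = record { fun = λ x → x ; inv = λ x → x
               ; invˡ = λ _ → Relation.Binary.PropositionalEquality.refl
               ; invʳ = λ _ → Relation.Binary.PropositionalEquality.refl
               ; adjPres = λ x y → Function.Bundles.mk⇔ (λ p → p) (λ p → p) }
  where import Function.Bundles

_≗A_ : ∀ {m q} → Aut m q → Aut m q → Set
_≗A_ {m} {q} g h = ∀ (x : Word m q) → fun g x ≡ fun h x

record IsAutGroup {m q : ℕ} (X : Aut m q → Set) : Set₁ where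
  field
    resp   : ∀ {g h} → g ≗A h → X g → X h
    hasId  : X idAut
    comp   : ∀ {g h} → X g → X h →
             Σ (Aut m q) λ k → X k × (∀ x → fun k x ≡ fun g (fun h x))
    invCl  : ∀ {g} → X g →
             Σ (Aut m q) λ k → X k × (∀ x → fun k x ≡ inv g x)

IsOrbit : ∀ {m q} → (Aut m q → Set) → Code m q → Set
IsOrbit {m} {q} X S =
  Σ (Word m q) λ γ → ∀ δ → (δ ∈C S) ⇔ (Σ (Aut m q) λ g → X g × (fun g γ ≡ δ))

CompletelyTransitive : ∀ {m q} → (Aut m q → Set) → Code m q → Set
CompletelyTransitive X C = ∀ i → i ≤ coveringRadius C → IsOrbit X (layer C i)

-- In H(m,q), summing over the neighbours δ of γ the number of vertices of a
-- code D at distance k from δ gives (k + 1) N_{k+1} + k (q − 2) N_k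
-- + (m − k + 1) (q − 1) N_{k−1}, where N_j counts the vertices of D at distance
-- j from γ. For C completely regular the counts a_k = N_k are constant on the
-- layers C_i, positive on C_k and zero on C_i for i > k. At a vertex of C_i the
-- neighbour sums of a_{i−1} and of a_i only see its neighbours in C_{i−1} and
-- C_i, so its numbers of neighbours in C_{i−1}, C_i and C_{i+1} depend only on
-- i: the distance partition is equitable. Hence every vertex of C_i with i < ρ
-- has a neighbour in C_{i+1}, so d(γ, C_ρ) = ρ − d(γ, C) and the distance
-- partition of C_ρ is that of C reversed, which settles the automorphisms and
-- the orbits. Read backwards, the identity determines N_{k+1} from N_k, N_{k−1}
-- and the neighbour sum; for D = C_ρ, a union of classes of an equitable
-- partition, induction on k makes every N_k constant on classes.
module Submission where

open import Defs
open import Data.Nat using (ℕ; _≤_; _∸_)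
open import Data.Product using (_×_)
open import Function using (_⇔_)
open import Relation.Binary.PropositionalEquality using (_≡_)

open import Algebra.Properties.CommutativeSemigroup using (interchange)
open import Data.Bool using (Bool; true; false; not; _∧_)
open import Data.Bool.Properties using (T-≡; ∧-zeroʳ; ∧-identityʳ)
open import Data.Fin using (Fin; zero; suc)
open import Data.Fin.Properties using (_≟_)
open import Data.List using (List; []; _∷_; map; length; filterᵇ; _++_; concatMap; allFin)
open import Data.List.Membership.Propositional using (_∈_)
open import Data.List.Membership.Propositional.Properties
  using (∈-filter⁺; ∈-filter⁻; ∈-map⁺; ∈-map⁻; ∈-++⁺ˡ; ∈-++⁺ʳ; ∈-++⁻; ∈-allFin; ∈-concatMap⁺; foldr-selective)
open import Data.List.Properties
  using (map-cong; length-map; length-++; map-tabulate; length-tabulate; foldr-preservesᵇ; foldr-preservesᵒ)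
open import Data.List.Relation.Unary.All as All using (All; []; _∷_)
open import Data.List.Relation.Unary.All.Properties using (map⁺)
open import Data.List.Relation.Unary.Any as Any using (here; there)
open import Data.Nat using (zero; suc; pred; _+_; _*_; _<_; _≡ᵇ_; _<ᵇ_; z≤n; s≤s; z<s; >-nonZero)
open import Data.Nat.ListAction using (sum)
open import Data.Nat.Properties hiding (_≟_)
open import Data.Nat.Tactic.RingSolver using (solve-∀)
open import Data.Product using (∃; _,_; proj₁; proj₂)
open import Data.Sum using (_⊎_; inj₁; inj₂; [_,_])
open import Data.Vec using ([]; _∷_)
open import Function using (id; _∘_; mk⇔; Equivalence)
open import Relation.Binary.PropositionalEquality
  using (_≢_; refl; sym; trans; cong; cong₂; subst; subst₂; ≡-≟-identity; ≢-≟-identity; module ≡-Reasoning)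
open import Relation.Nullary using (yes; no; contradiction)
open import Relation.Nullary.Decidable using (⌊_⌋; T?; ⌊⌋-map′)

private variable
  A B : Set

≡ᵇ-sound : ∀ {a b} → (a ≡ᵇ b) ≡ true → a ≡ b
≡ᵇ-sound {a} {b} e = ≡ᵇ⇒≡ a b (Equivalence.from T-≡ e)

≡ᵇ-complete : ∀ {a b} → a ≡ b → (a ≡ᵇ b) ≡ true
≡ᵇ-complete {a} {b} e = Equivalence.to T-≡ (≡⇒≡ᵇ a b e)

≡ᵇ-false : ∀ {a b} → a ≢ b → (a ≡ᵇ b) ≡ false
≡ᵇ-false {a} {b} a≢b with a ≡ᵇ b in eq
... | true  = contradiction (≡ᵇ-sound eq) a≢b
... | false = refl

<ᵇ-sound : ∀ {a b} → (a <ᵇ b) ≡ true → a < b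
<ᵇ-sound {a} {b} e = <ᵇ⇒< a b (Equivalence.from T-≡ e)

<ᵇ-complete : ∀ {a b} → a < b → (a <ᵇ b) ≡ true
<ᵇ-complete a<b = Equivalence.to T-≡ (<⇒<ᵇ a<b)

≡ᵇ-cong : ∀ {a b c d} → (a ≡ b ⇔ c ≡ d) → (a ≡ᵇ b) ≡ (c ≡ᵇ d)
≡ᵇ-cong {a} {b} {c} {d} a≡b⇔c≡d with a ≡ᵇ b in e₁ | c ≡ᵇ d in e₂
... | true  | true  = refl
... | false | false = refl
... | true  | false = trans (sym (≡ᵇ-complete (Equivalence.to a≡b⇔c≡d (≡ᵇ-sound e₁)))) e₂
... | false | true  = trans (sym e₁) (≡ᵇ-complete (Equivalence.from a≡b⇔c≡d (≡ᵇ-sound e₂)))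

𝟙 : Bool → ℕ
𝟙 true  = 1
𝟙 false = 0

∑ : (A → ℕ) → List A → ℕ
∑ f xs = sum (map f xs)

count : (A → Bool) → List A → ℕ
count p xs = length (filterᵇ p xs)

∑-cong : {f g : A → ℕ} → (∀ x → f x ≡ g x) → (xs : List A) → ∑ f xs ≡ ∑ g xs
∑-cong f≗g xs = cong sum (map-cong f≗g xs)

∑-distrib-+ : (f g : A → ℕ) (xs : List A) → ∑ (λ x → f x + g x) xs ≡ ∑ f xs + ∑ g xs
∑-distrib-+ f g []       = refl
∑-distrib-+ f g (x ∷ xs) =
  trans (cong (f x + g x +_) (∑-distrib-+ f g xs))
        (interchange +-commutativeSemigroup (f x) (g x) (∑ f xs) (∑ g xs))

∑-distribʳ-* : (f : A → ℕ) (c : ℕ) (xs : List A) → ∑ (λ x → f x * c) xs ≡ ∑ f xs * c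
∑-distribʳ-* f c []       = refl
∑-distribʳ-* f c (x ∷ xs) =
  trans (cong (f x * c +_) (∑-distribʳ-* f c xs)) (sym (*-distribʳ-+ c (f x) (∑ f xs)))

∑-zero : (xs : List A) → ∑ (λ _ → 0) xs ≡ 0
∑-zero []       = refl
∑-zero (_ ∷ xs) = ∑-zero xs

∑-comm : (f : A → B → ℕ) (xs : List A) (ys : List B) →
  ∑ (λ x → ∑ (f x) ys) xs ≡ ∑ (λ y → ∑ (λ x → f x y) xs) ys
∑-comm f []       ys = sym (∑-zero ys)
∑-comm f (x ∷ xs) ys =
  trans (cong (∑ (f x) ys +_) (∑-comm f xs ys)) (sym (∑-distrib-+ (f x) _ ys))

∑-const : {f : A → ℕ} (v : ℕ) {xs : List A} → All (λ x → f x ≡ v) xs → ∑ f xs ≡ length xs * v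
∑-const v []          = refl
∑-const v (fx≡v ∷ ps) = cong₂ _+_ fx≡v (∑-const v ps)

length≡∑1 : (xs : List A) → length xs ≡ ∑ (λ _ → 1) xs
length≡∑1 []       = refl
length≡∑1 (_ ∷ xs) = cong suc (length≡∑1 xs)

count≡∑𝟙 : (p : A → Bool) (xs : List A) → count p xs ≡ ∑ (𝟙 ∘ p) xs
count≡∑𝟙 p []       = refl
count≡∑𝟙 p (x ∷ xs) with p x
... | true  = cong suc (count≡∑𝟙 p xs)
... | false = count≡∑𝟙 p xs

count-comm : (R : A → B → Bool) (xs : List A) (ys : List B) →
  ∑ (λ x → count (R x) ys) xs ≡ ∑ (λ y → count (λ x → R x y) xs) ys
count-comm R xs ys = begin
  ∑ (λ x → count (R x) ys) xs          ≡⟨ ∑-cong (λ x → count≡∑𝟙 (R x) ys) xs ⟩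
  ∑ (λ x → ∑ (λ y → 𝟙 (R x y)) ys) xs  ≡⟨ ∑-comm (λ x y → 𝟙 (R x y)) xs ys ⟩
  ∑ (λ y → ∑ (λ x → 𝟙 (R x y)) xs) ys  ≡⟨ ∑-cong (λ y → count≡∑𝟙 (λ x → R x y) xs) ys ⟨
  ∑ (λ y → count (λ x → R x y) xs) ys  ∎
  where open ≡-Reasoning

∑-filterᵇ : (g : A → ℕ) (p : A → Bool) (xs : List A) → ∑ g (filterᵇ p xs) ≡ ∑ (λ x → 𝟙 (p x) * g x) xs
∑-filterᵇ g p []       = refl
∑-filterᵇ g p (x ∷ xs) with p x
... | true  = cong₂ _+_ (sym (+-identityʳ (g x))) (∑-filterᵇ g p xs)
... | false = ∑-filterᵇ g p xs

count-cong : {p r : A → Bool} → (∀ x → p x ≡ r x) → (xs : List A) → count p xs ≡ count r xs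
count-cong {p = p} {r} p≗r xs =
  trans (count≡∑𝟙 p xs) (trans (∑-cong (cong 𝟙 ∘ p≗r) xs) (sym (count≡∑𝟙 r xs)))

count-++ : (p : A → Bool) (xs ys : List A) → count p (xs ++ ys) ≡ count p xs + count p ys
count-++ p []       ys = refl
count-++ p (x ∷ xs) ys with p x
... | true  = cong suc (count-++ p xs ys)
... | false = count-++ p xs ys

count-map : (p : B → Bool) (f : A → B) (xs : List A) → count p (map f xs) ≡ count (p ∘ f) xs
count-map p f []       = refl
count-map p f (x ∷ xs) with p (f x)
... | true  = cong suc (count-map p f xs)
... | false = count-map p f xs

count-concatMap : (p : B → Bool) (f : A → List B) (xs : List A) →
  count p (concatMap f xs) ≡ ∑ (count p ∘ f) xs
count-concatMap p f []       = refl
count-concatMap p f (x ∷ xs) =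
  trans (count-++ p (f x) (concatMap f xs)) (cong (count p (f x) +_) (count-concatMap p f xs))

count-filterᵇ : (p r : A → Bool) (xs : List A) → count p (filterᵇ r xs) ≡ count (λ x → r x ∧ p x) xs
count-filterᵇ p r []       = refl
count-filterᵇ p r (x ∷ xs) with r x
... | false = count-filterᵇ p r xs
... | true with p x
...   | true  = cong suc (count-filterᵇ p r xs)
...   | false = count-filterᵇ p r xs

count+count-not : (p : A → Bool) (xs : List A) → count p xs + count (not ∘ p) xs ≡ length xs
count+count-not p []       = refl
count+count-not p (x ∷ xs) with p x
... | true  = cong suc (count+count-not p xs)
... | false = trans (+-suc _ _) (cong suc (count+count-not p xs))

count-not : (p : A → Bool) (xs : List A) → count (not ∘ p) xs ≡ length xs ∸ count p xs
count-not p xs =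
  sym (trans (cong (_∸ count p xs) (sym (count+count-not p xs))) (m+n∸m≡n (count p xs) _))

count-∘ : (h : Bool → Bool) (p : A → Bool) (xs : List A) →
  count (h ∘ p) xs ≡ count p xs * 𝟙 (h true) + count (not ∘ p) xs * 𝟙 (h false)
count-∘ h p xs = begin
  count (h ∘ p) xs
    ≡⟨ count≡∑𝟙 (h ∘ p) xs ⟩
  ∑ (𝟙 ∘ h ∘ p) xs
    ≡⟨ ∑-cong (split ∘ p) xs ⟩
  ∑ (λ x → 𝟙 (p x) * 𝟙 (h true) + 𝟙 (not (p x)) * 𝟙 (h false)) xs
    ≡⟨ ∑-distrib-+ _ _ xs ⟩
  ∑ (λ x → 𝟙 (p x) * 𝟙 (h true)) xs + ∑ (λ x → 𝟙 (not (p x)) * 𝟙 (h false)) xs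
    ≡⟨ cong₂ _+_ (∑-distribʳ-* (𝟙 ∘ p) _ xs) (∑-distribʳ-* (𝟙 ∘ not ∘ p) _ xs) ⟩
  ∑ (𝟙 ∘ p) xs * 𝟙 (h true) + ∑ (𝟙 ∘ not ∘ p) xs * 𝟙 (h false)
    ≡⟨ cong₂ _+_ (cong (_* _) (count≡∑𝟙 p xs)) (cong (_* _) (count≡∑𝟙 (not ∘ p) xs)) ⟨
  count p xs * 𝟙 (h true) + count (not ∘ p) xs * 𝟙 (h false) ∎
  where
  open ≡-Reasoning
  split : ∀ b → 𝟙 (h b) ≡ 𝟙 b * 𝟙 (h true) + 𝟙 (not b) * 𝟙 (h false)
  split true  = sym (trans (+-identityʳ _) (*-identityˡ _))
  split false = sym (*-identityˡ _)

∑-𝟙≡ᵇ : (κ : A → ℕ) (h : ℕ → ℕ) (j : ℕ) (xs : List A) →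
  ∑ (λ x → 𝟙 (κ x ≡ᵇ j) * h (κ x)) xs ≡ count (λ x → κ x ≡ᵇ j) xs * h j
∑-𝟙≡ᵇ κ h j xs = begin
  ∑ (λ x → 𝟙 (κ x ≡ᵇ j) * h (κ x)) xs  ≡⟨ ∑-cong (λ x → at-j (κ x)) xs ⟩
  ∑ (λ x → 𝟙 (κ x ≡ᵇ j) * h j) xs      ≡⟨ ∑-distribʳ-* (λ x → 𝟙 (κ x ≡ᵇ j)) (h j) xs ⟩
  ∑ (λ x → 𝟙 (κ x ≡ᵇ j)) xs * h j      ≡⟨ cong (_* h j) (count≡∑𝟙 (λ x → κ x ≡ᵇ j) xs) ⟨
  count (λ x → κ x ≡ᵇ j) xs * h j      ∎
  where
  open ≡-Reasoning
  at-j : ∀ n → 𝟙 (n ≡ᵇ j) * h n ≡ 𝟙 (n ≡ᵇ j) * h j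
  at-j n with n ≡ᵇ j in eq
  ... | true  = cong (λ k → 1 * h k) (≡ᵇ-sound eq)
  ... | false = refl

count-none : {p : A → Bool} {xs : List A} → (∀ {x} → x ∈ xs → p x ≡ false) → count p xs ≡ 0
count-none {xs = []}     _    = refl
count-none {p = p} {xs = x ∷ xs} none with p x | none (here refl)
... | false | refl = count-none (none ∘ there)

∈-filterᵇ⁺ : (p : A → Bool) {x : A} {xs : List A} → x ∈ xs → p x ≡ true → x ∈ filterᵇ p xs
∈-filterᵇ⁺ p x∈xs px = ∈-filter⁺ (T? ∘ p) x∈xs (Equivalence.from T-≡ px)

∈-filterᵇ⁻ : (p : A → Bool) {x : A} {xs : List A} → x ∈ filterᵇ p xs → x ∈ xs × p x ≡ true
∈-filterᵇ⁻ p x∈ with ∈-filter⁻ (T? ∘ p) x∈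
... | x∈xs , px = x∈xs , Equivalence.to T-≡ px

All-filterᵇ : {P Q : A → Set} (p : A → Bool) {xs : List A} →
  (∀ {x} → P x → p x ≡ true → Q x) → All P xs → All Q (filterᵇ p xs)
All-filterᵇ p P⇒Q []                        = []
All-filterᵇ p P⇒Q (_∷_ {x} Px Pxs) with p x in px
... | true  = P⇒Q Px px ∷ All-filterᵇ p P⇒Q Pxs
... | false = All-filterᵇ p P⇒Q Pxs

∈⇒length>0 : {x : A} {xs : List A} → x ∈ xs → 0 < length xs
∈⇒length>0 (here _)  = s≤s z≤n
∈⇒length>0 (there _) = s≤s z≤n

length>0⇒∈ : {xs : List A} → 0 < length xs → ∃ λ x → x ∈ xs
length>0⇒∈ {xs = []}    ()
length>0⇒∈ {xs = x ∷ _} _ = x , here refl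

𝟙<+𝟙≡+𝟙> : ∀ a b → 𝟙 (a <ᵇ b) + 𝟙 (a ≡ᵇ b) + 𝟙 (b <ᵇ a) ≡ 1
𝟙<+𝟙≡+𝟙> zero    zero    = refl
𝟙<+𝟙≡+𝟙> zero    (suc b) = refl
𝟙<+𝟙≡+𝟙> (suc a) zero    = refl
𝟙<+𝟙≡+𝟙> (suc a) (suc b) = 𝟙<+𝟙≡+𝟙> a b

∑-trichotomy : (κ : A → ℕ) (c : ℕ) (g : A → ℕ) (xs : List A) →
  ∑ g xs ≡ ∑ g (filterᵇ (λ x → κ x <ᵇ c) xs) + ∑ g (filterᵇ (λ x → κ x ≡ᵇ c) xs)
           + ∑ g (filterᵇ (λ x → c <ᵇ κ x) xs)
∑-trichotomy κ c g xs = begin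
  ∑ g xs                            ≡⟨ ∑-cong split xs ⟩
  ∑ (λ x → L x + E x + G x) xs      ≡⟨ ∑-distrib-+ (λ x → L x + E x) G xs ⟩
  ∑ (λ x → L x + E x) xs + ∑ G xs   ≡⟨ cong (_+ ∑ G xs) (∑-distrib-+ L E xs) ⟩
  ∑ L xs + ∑ E xs + ∑ G xs
    ≡⟨ cong₂ _+_ (cong₂ _+_ (∑-filterᵇ g _ xs) (∑-filterᵇ g _ xs)) (∑-filterᵇ g _ xs) ⟨
  ∑ g (filterᵇ (λ x → κ x <ᵇ c) xs) + ∑ g (filterᵇ (λ x → κ x ≡ᵇ c) xs)
    + ∑ g (filterᵇ (λ x → c <ᵇ κ x) xs) ∎
  where
  open ≡-Reasoning
  L E G : _ → ℕ
  L x = 𝟙 (κ x <ᵇ c) * g x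
  E x = 𝟙 (κ x ≡ᵇ c) * g x
  G x = 𝟙 (c <ᵇ κ x) * g x
  split : ∀ x → g x ≡ L x + E x + G x
  split x = begin
    g x                                                   ≡⟨ *-identityˡ (g x) ⟨
    1 * g x                                               ≡⟨ cong (_* g x) (𝟙<+𝟙≡+𝟙> (κ x) c) ⟨
    (𝟙 (κ x <ᵇ c) + 𝟙 (κ x ≡ᵇ c) + 𝟙 (c <ᵇ κ x)) * g x  ≡⟨ *-distribʳ-+ (g x) (𝟙 (κ x <ᵇ c) + 𝟙 (κ x ≡ᵇ c)) _ ⟩
    (𝟙 (κ x <ᵇ c) + 𝟙 (κ x ≡ᵇ c)) * g x + G x           ≡⟨ cong (_+ G x) (*-distribʳ-+ (g x) (𝟙 (κ x <ᵇ c)) _) ⟩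
    L x + E x + G x                                       ∎

module _ {P : A → Set} {g : A → ℕ} (g-const : ∀ x y → P x → P y → g x ≡ g y) where

  length≡⇒∑≡ : {xs ys : List A} → All P xs → All P ys → length xs ≡ length ys → ∑ g xs ≡ ∑ g ys
  length≡⇒∑≡ []         []         _ = refl
  length≡⇒∑≡ (Px ∷ Pxs) (Py ∷ Pys) e =
    cong₂ _+_ (g-const _ _ Px Py) (length≡⇒∑≡ Pxs Pys (suc-injective e))

  ∑≡⇒length≡ : (∀ x → P x → 0 < g x) →
    {xs ys : List A} → All P xs → All P ys → ∑ g xs ≡ ∑ g ys → length xs ≡ length ys
  ∑≡⇒length≡ g>0 []         []         _ = refl
  ∑≡⇒length≡ g>0 []         (Py ∷ _)   e = contradiction e (<⇒≢ (<-≤-trans (g>0 _ Py) (m≤m+n _ _)))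
  ∑≡⇒length≡ g>0 (Px ∷ _)   []         e = contradiction (sym e) (<⇒≢ (<-≤-trans (g>0 _ Px) (m≤m+n _ _)))
  ∑≡⇒length≡ g>0 {x ∷ _} Pxs@(Px ∷ _) Pys@(_ ∷ _) e = *-cancelʳ-≡ _ _ (g x) {{>-nonZero (g>0 x Px)}}
    (trans (sym (∑-const (g x) (constant Pxs))) (trans e (∑-const (g x) (constant Pys))))
    where
    constant : ∀ {zs} → All P zs → All (λ z → g z ≡ g x) zs
    constant = All.map (λ Pz → g-const _ x Pz Px)

≟-refl : ∀ {q} (a : Fin q) → ⌊ a ≟ a ⌋ ≡ true
≟-refl a = cong ⌊_⌋ (≡-≟-identity _≟_ refl)

≟-≢ : ∀ {q} {a b : Fin q} → a ≢ b → ⌊ a ≟ b ⌋ ≡ false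
≟-≢ a≢b = cong ⌊_⌋ (≢-≟-identity _≟_ a≢b)

mismatch : ∀ {q} → Fin q → Fin q → ℕ
mismatch a b = 𝟙 (not ⌊ a ≟ b ⌋)

mismatch-refl : ∀ {q} (a : Fin q) → mismatch a a ≡ 0
mismatch-refl a = cong (𝟙 ∘ not) (≟-refl a)

mismatch-≢ : ∀ {q} {a b : Fin q} → a ≢ b → mismatch a b ≡ 1
mismatch-≢ a≢b = cong (𝟙 ∘ not) (≟-≢ a≢b)

mismatch-sym : ∀ {q} (a b : Fin q) → mismatch a b ≡ mismatch b a
mismatch-sym a b with a ≟ b | b ≟ a
... | yes _   | yes _   = refl
... | no  _   | no  _   = refl
... | yes a≡b | no  b≢a = contradiction (sym a≡b) b≢a
... | no  a≢b | yes b≡a = contradiction (sym b≡a) a≢b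

mismatch≤1 : ∀ {q} (a b : Fin q) → mismatch a b ≤ 1
mismatch≤1 a b with a ≟ b
... | yes _ = z≤n
... | no  _ = s≤s z≤n

mismatch-triangle : ∀ {q} (a b c : Fin q) → mismatch a c ≤ mismatch a b + mismatch b c
mismatch-triangle a b c with a ≟ c | a ≟ b | b ≟ c
... | yes _ | _       | _       = z≤n
... | no _  | no _    | _       = s≤s z≤n
... | no _  | yes _   | no _    = s≤s z≤n
... | no a≢c | yes refl | yes refl = contradiction refl a≢c

hd-∷ : ∀ {m q} (a b : Fin q) (x y : Word m q) → hd (a ∷ x) (b ∷ y) ≡ mismatch a b + hd x y
hd-∷ a b x y with a ≟ b
... | yes _ = refl
... | no  _ = refl

hd-∷-≡ : ∀ {m q} (a : Fin q) (x y : Word m q) → hd (a ∷ x) (a ∷ y) ≡ hd x y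
hd-∷-≡ a x y = trans (hd-∷ a a x y) (cong (_+ hd x y) (mismatch-refl a))

hd-∷-≢ : ∀ {m q} {a b : Fin q} → a ≢ b → (x y : Word m q) → hd (a ∷ x) (b ∷ y) ≡ suc (hd x y)
hd-∷-≢ {a = a} {b} a≢b x y = trans (hd-∷ a b x y) (cong (_+ hd x y) (mismatch-≢ a≢b))

hd-refl : ∀ {m q} (x : Word m q) → hd x x ≡ 0
hd-refl []      = refl
hd-refl (a ∷ x) = trans (hd-∷-≡ a x x) (hd-refl x)

hd-sym : ∀ {m q} (x y : Word m q) → hd x y ≡ hd y x
hd-sym []      []      = refl
hd-sym (a ∷ x) (b ∷ y) =
  trans (hd-∷ a b x y) (trans (cong₂ _+_ (mismatch-sym a b) (hd-sym x y)) (sym (hd-∷ b a y x)))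

hd≤m : ∀ {m q} (x y : Word m q) → hd x y ≤ m
hd≤m []      []      = z≤n
hd≤m (a ∷ x) (b ∷ y) = subst (_≤ _) (sym (hd-∷ a b x y)) (+-mono-≤ (mismatch≤1 a b) (hd≤m x y))

hd≡0⇒≡ : ∀ {m q} (x y : Word m q) → hd x y ≡ 0 → x ≡ y
hd≡0⇒≡ []      []      _ = refl
hd≡0⇒≡ (a ∷ x) (b ∷ y) e with a ≟ b
... | yes a≡b = cong₂ _∷_ a≡b (hd≡0⇒≡ x y e)

hd-triangle : ∀ {m q} (x y z : Word m q) → hd x z ≤ hd x y + hd y z
hd-triangle []      []      []      = z≤n
hd-triangle (a ∷ x) (b ∷ y) (c ∷ z) = begin
  hd (a ∷ x) (c ∷ z)                                  ≡⟨ hd-∷ a c x z ⟩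
  mismatch a c + hd x z                               ≤⟨ +-mono-≤ (mismatch-triangle a b c) (hd-triangle x y z) ⟩
  (mismatch a b + mismatch b c) + (hd x y + hd y z)   ≡⟨ interchange +-commutativeSemigroup (mismatch a b) _ _ _ ⟩
  (mismatch a b + hd x y) + (mismatch b c + hd y z)   ≡⟨ cong₂ _+_ (hd-∷ a b x y) (hd-∷ b c y z) ⟨
  hd (a ∷ x) (b ∷ y) + hd (b ∷ y) (c ∷ z)             ∎
  where open ≤-Reasoning

geodesic : ∀ {m q} (x y : Word m q) (j : ℕ) → j ≤ hd x y →
  ∃ λ u → hd x u ≡ j × j + hd u y ≡ hd x y
geodesic x       y       zero    _  = x , hd-refl x , refl
geodesic []      []      (suc j) ()
geodesic (a ∷ x) (b ∷ y) (suc j) j< with a ≟ b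
... | yes refl with geodesic x y (suc j) j<
...   | u , xu≡j , j+uy≡xy =
  a ∷ u , trans (hd-∷-≡ a x u) xu≡j
        , trans (cong (suc j +_) (hd-∷-≡ a u y)) j+uy≡xy
geodesic (a ∷ x) (b ∷ y) (suc j) j< | no a≢b
  with geodesic x y j (≤-pred j<)
...   | u , xu≡j , j+uy≡xy =
  b ∷ u , trans (hd-∷-≢ a≢b x u) (cong suc xu≡j)
        , trans (cong (suc j +_) (hd-∷-≡ b u y)) (cong suc j+uy≡xy)

∈-words : ∀ {m q} (x : Word m q) → x ∈ words m q
∈-words []               = here refl
∈-words {suc m} {q} (a ∷ x) =
  ∈-concatMap⁺ (λ b → map (b ∷_) (words m q)) (Any.map (λ { refl → ∈-map⁺ (a ∷_) (∈-words x) }) (∈-allFin a))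

minList-≤ : ∀ d {xs y} → y ∈ xs → minList d xs ≤ y
minList-≤ d {x ∷ xs} {y} y∈ =
  foldr-preservesᵒ {P = _≤ y} (λ a b → [ m≤n⇒m⊓o≤n b , m≤n⇒o⊓m≤n a ]) x xs (≤-witness y∈)
  where
  ≤-witness : y ∈ x ∷ xs → x ≤ y ⊎ Any.Any (_≤ y) xs
  ≤-witness (here y≡x)  = inj₁ (≤-reflexive (sym y≡x))
  ≤-witness (there y∈xs) = inj₂ (Any.map (≤-reflexive ∘ sym) y∈xs)

minList-∈ : ∀ d {xs y} → y ∈ xs → minList d xs ∈ xs
minList-∈ d {x ∷ xs} _ with foldr-selective ⊓-sel x xs
... | inj₁ min≡x  = here min≡x
... | inj₂ min∈xs = there min∈xs

minList-glb : ∀ {b} d {xs} → b ≤ d → All (b ≤_) xs → b ≤ minList d xs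
minList-glb d b≤d []           = b≤d
minList-glb d _   (b≤x ∷ b≤xs) = foldr-preservesᵇ ⊓-glb b≤x b≤xs

module _ {m q : ℕ} (C : Code m q) where

  ∈-codewords : ∀ {c} → c ∈C C → c ∈ codewords C
  ∈-codewords c∈C = ∈-filterᵇ⁺ C (∈-words _) c∈C

  ∈-codewords⁻ : ∀ {c} → c ∈ codewords C → c ∈C C
  ∈-codewords⁻ c∈ = proj₂ (∈-filterᵇ⁻ C {xs = words m q} c∈)

  dist≤hd : ∀ γ {c} → c ∈C C → dist γ C ≤ hd γ c
  dist≤hd γ c∈C = minList-≤ m (∈-map⁺ (hd γ) (∈-codewords c∈C))

  nearest : NonEmpty C → ∀ γ → ∃ λ c → c ∈C C × hd γ c ≡ dist γ C
  nearest (_ , c₀∈C) γ with ∈-map⁻ (hd γ) (minList-∈ m (∈-map⁺ (hd γ) (∈-codewords c₀∈C)))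
  ... | c , c∈ , dist≡hd = c , ∈-codewords⁻ c∈ , sym dist≡hd

  dist-glb : ∀ γ {b} → b ≤ m → (∀ c → c ∈C C → b ≤ hd γ c) → b ≤ dist γ C
  dist-glb γ b≤m b≤hd =
    minList-glb m b≤m (map⁺ (All.tabulate (λ c∈ → b≤hd _ (∈-codewords⁻ c∈))))

  dist-triangle : NonEmpty C → ∀ γ δ → dist γ C ≤ hd γ δ + dist δ C
  dist-triangle ne γ δ with nearest ne δ
  ... | c , c∈C , hd≡dist = begin
    dist γ C           ≤⟨ dist≤hd γ c∈C ⟩
    hd γ c             ≤⟨ hd-triangle γ δ c ⟩
    hd γ δ + hd δ c    ≡⟨ cong (hd γ δ +_) hd≡dist ⟩
    hd γ δ + dist δ C  ∎
    where open ≤-Reasoning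

  dist≤m : NonEmpty C → ∀ γ → dist γ C ≤ m
  dist≤m (c , c∈C) γ = ≤-trans (dist≤hd γ c∈C) (hd≤m γ c)

  ∈⇒dist≡0 : ∀ {γ} → γ ∈C C → dist γ C ≡ 0
  ∈⇒dist≡0 {γ} γ∈C = n≤0⇒n≡0 (subst (dist γ C ≤_) (hd-refl γ) (dist≤hd γ γ∈C))

  dist≡0⇒∈ : NonEmpty C → ∀ {γ} → dist γ C ≡ 0 → γ ∈C C
  dist≡0⇒∈ ne {γ} dist≡0 with nearest ne γ
  ... | c , c∈C , hd≡dist = subst (_∈C C) (sym (hd≡0⇒≡ γ c (trans hd≡dist dist≡0))) c∈C

  layer-zero : NonEmpty C → ∀ γ → layer C 0 γ ≡ C γ
  layer-zero ne γ with C γ in Cγ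
  ... | true  = ≡ᵇ-complete (∈⇒dist≡0 Cγ)
  ... | false = ≡ᵇ-false (λ dist≡0 → contradiction (trans (sym Cγ) (dist≡0⇒∈ ne dist≡0)) λ ())

  dist-geodesic : ∀ {c w u} → c ∈C C → hd w c ≡ dist w C → hd c u + hd u w ≡ hd c w →
    dist u C ≡ hd c u
  dist-geodesic {c} {w} {u} c∈C nearest-w on-geodesic =
    ≤-antisym (subst (dist u C ≤_) (hd-sym u c) (dist≤hd u c∈C))
              (+-cancelʳ-≤ (hd u w) (hd c u) (dist u C) (begin
      hd c u + hd u w    ≡⟨ on-geodesic ⟩
      hd c w             ≡⟨ trans (hd-sym c w) nearest-w ⟩
      dist w C           ≤⟨ dist-triangle (c , c∈C) w u ⟩
      hd w u + dist u C  ≡⟨ trans (cong (_+ dist u C) (hd-sym w u)) (+-comm (hd u w) _) ⟩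
      dist u C + hd u w  ∎))
    where open ≤-Reasoning

  dist≤coveringRadius : ∀ γ → dist γ C ≤ coveringRadius C
  dist≤coveringRadius γ =
    foldr-preservesᵒ {P = dist γ C ≤_} (λ a b → [ m≤n⇒m≤n⊔o b , m≤n⇒m≤o⊔n a ]) 0 _
      (inj₂ (Any.map ≤-reflexive (∈-map⁺ (λ δ → dist δ C) (∈-words γ))))

  coveringRadius-lub : ∀ {b} → (∀ γ → dist γ C ≤ b) → coveringRadius C ≤ b
  coveringRadius-lub {b} dist≤b =
    foldr-preservesᵇ {P = _≤ b} ⊔-lub z≤n (map⁺ (All.universal dist≤b (words m q)))

  coveringRadius-attained : NonEmpty C → ∃ λ w → dist w C ≡ coveringRadius C
  coveringRadius-attained (c , c∈C) with foldr-selective ⊔-sel 0 (map (λ γ → dist γ C) (words m q))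
  ... | inj₁ ρ≡0 = c , trans (∈⇒dist≡0 c∈C) (sym ρ≡0)
  ... | inj₂ ρ∈  with ∈-map⁻ (λ γ → dist γ C) ρ∈
  ...   | w , _ , ρ≡dist = w , sym ρ≡dist

-- Automorphisms of H(m,q) are isometries

module _ {m q : ℕ} where

  hd-nonexpanding : (f : Word m q → Word m q) → (∀ x y → Adj x y → Adj (f x) (f y)) →
    ∀ x y → hd (f x) (f y) ≤ hd x y
  hd-nonexpanding f f-adj x y = go (hd x y) x y refl
    where
    open ≤-Reasoning
    go : ∀ n x y → hd x y ≡ n → hd (f x) (f y) ≤ n
    go zero    x y x≡y rewrite hd≡0⇒≡ x y x≡y = ≤-reflexive (hd-refl (f y))
    go (suc n) x y xy≡ with geodesic x y 1 (subst (1 ≤_) (sym xy≡) (s≤s z≤n))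
    ... | u , xu≡1 , 1+uy≡xy = begin
      hd (f x) (f y)                   ≤⟨ hd-triangle (f x) (f u) (f y) ⟩
      hd (f x) (f u) + hd (f u) (f y)  ≤⟨ +-mono-≤ (≤-reflexive (f-adj x u xu≡1))
                                                   (go n u y (suc-injective (trans 1+uy≡xy xy≡))) ⟩
      1 + n                            ∎

  hd-fun : (g : Aut m q) → ∀ x y → hd (fun g x) (fun g y) ≡ hd x y
  hd-fun g x y = ≤-antisym
    (hd-nonexpanding (fun g) (λ x y → Equivalence.to (adjPres g x y)) x y)
    (subst₂ (λ a b → hd a b ≤ hd (fun g x) (fun g y)) (invˡ g x) (invˡ g y)
      (hd-nonexpanding (inv g) inv-adj (fun g x) (fun g y)))
    where
    inv-adj : ∀ x y → Adj x y → Adj (inv g x) (inv g y)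
    inv-adj x y xy = Equivalence.from (adjPres g (inv g x) (inv g y))
      (subst₂ Adj (sym (invʳ g x)) (sym (invʳ g y)) xy)

  dist-fun : (g : Aut m q) (D : Code m q) → NonEmpty D → Stabilises g D →
    ∀ γ → dist (fun g γ) D ≡ dist γ D
  dist-fun g D ne g-stab γ with nearest D ne γ | nearest D ne (fun g γ)
  ... | c , c∈D , γc≡dist | c′ , c′∈D , gγc′≡dist = ≤-antisym
    (begin
      dist (fun g γ) D          ≤⟨ dist≤hd D (fun g γ) (trans (g-stab c) c∈D) ⟩
      hd (fun g γ) (fun g c)    ≡⟨ hd-fun g γ c ⟩
      hd γ c                    ≡⟨ γc≡dist ⟩
      dist γ D                  ∎)
    (begin
      dist γ D                  ≤⟨ dist≤hd D γ (trans (sym (g-stab c″)) (trans (cong D (invʳ g c′)) c′∈D)) ⟩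
      hd γ c″                   ≡⟨ hd-fun g γ c″ ⟨
      hd (fun g γ) (fun g c″)   ≡⟨ cong (hd (fun g γ)) (invʳ g c′) ⟩
      hd (fun g γ) c′           ≡⟨ gγc′≡dist ⟩
      dist (fun g γ) D          ∎)
    where
    open ≤-Reasoning
    c″ = inv g c′

  stabilises-layer : (g : Aut m q) (D : Code m q) → NonEmpty D → Stabilises g D →
    ∀ i → Stabilises g (layer D i)
  stabilises-layer g D ne g-stab i x = cong (_≡ᵇ i) (dist-fun g D ne g-stab x)

IsOrbit-cong : ∀ {m q} (X : Aut m q → Set) {S T : Code m q} →
  (∀ δ → S δ ≡ T δ) → IsOrbit X S → IsOrbit X T
IsOrbit-cong X S≗T (γ , orbit) = γ , λ δ → mk⇔
  (λ δ∈T → Equivalence.to (orbit δ) (trans (S≗T δ) δ∈T))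
  (λ δ∈Xγ → trans (sym (S≗T δ)) (Equivalence.from (orbit δ) δ∈Xγ))

others : ∀ {q} → Fin q → List (Fin q)
others {q} g = filterᵇ (λ a → not ⌊ a ≟ g ⌋) (allFin q)

neighbours : ∀ {m q} → Word m q → List (Word m q)
neighbours []      = []
neighbours (g ∷ γ) = map (_∷ γ) (others g) ++ map (g ∷_) (neighbours γ)

∈-others⁺ : ∀ {q} {a g : Fin q} → a ≢ g → a ∈ others g
∈-others⁺ {a = a} a≢g = ∈-filterᵇ⁺ _ (∈-allFin a) (cong not (≟-≢ a≢g))

∈-others⁻ : ∀ {q} {a g : Fin q} → a ∈ others g → a ≢ g
∈-others⁻ {a = a} a∈ refl with ∈-filterᵇ⁻ (λ b → not ⌊ b ≟ a ⌋) {xs = allFin _} a∈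
... | _ , a≢a = contradiction (trans (cong not (sym (≟-refl a))) a≢a) λ ()

count-≟-allFin : ∀ {q} (x : Fin q) → count (λ a → ⌊ a ≟ x ⌋) (allFin q) ≡ 1
count-≟-allFin {suc q} x = trans (cong (count (λ a → ⌊ a ≟ x ⌋)) allFin-suc) (at x)
  where
  allFin-suc : allFin (suc q) ≡ zero ∷ map suc (allFin q)
  allFin-suc = cong (zero ∷_) (sym (map-tabulate id suc))
  at : (x : Fin (suc q)) → count (λ a → ⌊ a ≟ x ⌋) (zero ∷ map suc (allFin q)) ≡ 1
  at zero    = cong suc (trans (count-map _ suc (allFin q)) (count-none {xs = allFin q} (λ _ → refl)))
  at (suc x) = trans (count-map _ suc (allFin q))
    (trans (count-cong (λ a → ⌊⌋-map′ _ _ (a ≟ x)) (allFin q)) (count-≟-allFin x))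

length-others : ∀ {q} (g : Fin q) → length (others g) ≡ q ∸ 1
length-others {q} g = trans (count-not (λ a → ⌊ a ≟ g ⌋) (allFin q))
  (cong₂ _∸_ (length-tabulate {n = q} id) (count-≟-allFin g))

count-≟-others : ∀ {q} {x g : Fin q} → x ≢ g → count (λ a → ⌊ a ≟ x ⌋) (others g) ≡ 1
count-≟-others {q} {x} {g} x≢g = trans (count-filterᵇ _ _ (allFin q))
  (trans (count-cong only-x (allFin q)) (count-≟-allFin x))
  where
  only-x : ∀ a → (not ⌊ a ≟ g ⌋ ∧ ⌊ a ≟ x ⌋) ≡ ⌊ a ≟ x ⌋
  only-x a with a ≟ x
  ... | yes refl = trans (∧-identityʳ _) (cong not (≟-≢ x≢g))
  ... | no  _    = ∧-zeroʳ _

count-≟-others-self : ∀ {q} (g : Fin q) → count (λ a → ⌊ a ≟ g ⌋) (others g) ≡ 0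
count-≟-others-self {q} g =
  trans (count-filterᵇ _ _ (allFin q)) (count-none {xs = allFin q} (λ {a} _ → never a))
  where
  never : ∀ a → (not ⌊ a ≟ g ⌋ ∧ ⌊ a ≟ g ⌋) ≡ false
  never a with a ≟ g
  ... | yes _ = refl
  ... | no  _ = refl

length-neighbours : ∀ {m q} (γ : Word m q) → length (neighbours γ) ≡ m * (q ∸ 1)
length-neighbours []      = refl
length-neighbours {suc m} {q} (g ∷ γ) = begin
  length (map (_∷ γ) (others g) ++ map (g ∷_) (neighbours γ))
    ≡⟨ length-++ (map (_∷ γ) (others g)) ⟩
  length (map (_∷ γ) (others g)) + length (map (g ∷_) (neighbours γ))
    ≡⟨ cong₂ _+_ (trans (length-map _ (others g)) (length-others g))
                 (trans (length-map _ (neighbours γ)) (length-neighbours γ)) ⟩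
  (q ∸ 1) + m * (q ∸ 1) ∎
  where open ≡-Reasoning

∈-neighbours⁺ : ∀ {m q} (γ δ : Word m q) → hd γ δ ≡ 1 → δ ∈ neighbours γ
∈-neighbours⁺ []      []      ()
∈-neighbours⁺ (g ∷ γ) (a ∷ δ) γδ≡1 with g ≟ a
... | yes refl = ∈-++⁺ʳ (map (_∷ γ) (others g)) (∈-map⁺ (g ∷_) (∈-neighbours⁺ γ δ γδ≡1))
... | no  g≢a  = subst (λ z → a ∷ z ∈ neighbours (g ∷ γ)) (hd≡0⇒≡ γ δ (suc-injective γδ≡1))
  (∈-++⁺ˡ (∈-map⁺ (_∷ γ) (∈-others⁺ (g≢a ∘ sym))))

∈-neighbours⁻ : ∀ {m q} (γ δ : Word m q) → δ ∈ neighbours γ → hd γ δ ≡ 1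
∈-neighbours⁻ (g ∷ γ) δ δ∈ with ∈-++⁻ (map (_∷ γ) (others g)) δ∈
... | inj₁ δ∈₁ with ∈-map⁻ (_∷ γ) δ∈₁
...   | a , a∈ , refl = trans (hd-∷-≢ (∈-others⁻ a∈ ∘ sym) γ γ) (cong suc (hd-refl γ))
∈-neighbours⁻ (g ∷ γ) δ δ∈ | inj₂ δ∈₂ with ∈-map⁻ (g ∷_) δ∈₂
...   | δ′ , δ′∈ , refl = trans (hd-∷-≡ g γ δ′) (∈-neighbours⁻ γ δ′ δ′∈)

neighboursAt : ∀ {m q} → Word m q → Word m q → ℕ → ℕ
neighboursAt γ s e = count (λ δ → hd δ s ≡ᵇ e) (neighbours γ)

-- A vertex at distance d from s has d neighbours at distance d − 1 from s,
-- d (q − 2) at distance d, and (m − d) (q − 1) at distance d + 1.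
intersectionNumber : (q m d e : ℕ) → ℕ
intersectionNumber q m d e =
  𝟙 (d ≡ᵇ suc e) * d + 𝟙 (d ≡ᵇ e) * (d * (q ∸ 2)) + 𝟙 (suc d ≡ᵇ e) * ((m ∸ d) * (q ∸ 1))

neighboursAt-∷ : ∀ {m q} (g x : Fin q) (γ s : Word m q) (e : ℕ) →
  neighboursAt (g ∷ γ) (x ∷ s) e ≡
    count (λ a → ⌊ a ≟ x ⌋) (others g) * 𝟙 (hd γ s ≡ᵇ e)
    + count (λ a → not ⌊ a ≟ x ⌋) (others g) * 𝟙 (suc (hd γ s) ≡ᵇ e)
    + count (λ δ → mismatch g x + hd δ s ≡ᵇ e) (neighbours γ)
neighboursAt-∷ g x γ s e = begin
  count P (map (_∷ γ) (others g) ++ map (g ∷_) (neighbours γ))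
    ≡⟨ count-++ P (map (_∷ γ) (others g)) _ ⟩
  count P (map (_∷ γ) (others g)) + count P (map (g ∷_) (neighbours γ))
    ≡⟨ cong₂ _+_ (count-map P (_∷ γ) (others g)) (count-map P (g ∷_) (neighbours γ)) ⟩
  count (P ∘ (_∷ γ)) (others g) + count (P ∘ (g ∷_)) (neighbours γ)
    ≡⟨ cong₂ _+_ (trans (count-cong (λ a → cong (_≡ᵇ e) (hd-∷ a x γ s)) (others g))
                        (count-∘ (λ b → 𝟙 (not b) + hd γ s ≡ᵇ e) (λ a → ⌊ a ≟ x ⌋) (others g)))
                 (count-cong (λ δ → cong (_≡ᵇ e) (hd-∷ g x δ s)) (neighbours γ)) ⟩
  _ ∎
  where
  open ≡-Reasoning
  P = λ δ → hd δ (x ∷ s) ≡ᵇ e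

neighboursAt-same : ∀ {m q} (g : Fin q) (γ s : Word m q) (e : ℕ) →
  neighboursAt (g ∷ γ) (g ∷ s) e ≡ (q ∸ 1) * 𝟙 (suc (hd γ s) ≡ᵇ e) + neighboursAt γ s e
neighboursAt-same {q = q} g γ s e =
  trans (neighboursAt-∷ g g γ s e)
    (cong₂ _+_ (cong₂ (λ a b → a * 𝟙 (hd γ s ≡ᵇ e) + b * 𝟙 (suc (hd γ s) ≡ᵇ e))
                      (count-≟-others-self g) others≢g)
               (count-cong (λ δ → cong (λ k → k + hd δ s ≡ᵇ e) (mismatch-refl g)) (neighbours γ)))
  where
  others≢g : count (λ a → not ⌊ a ≟ g ⌋) (others g) ≡ q ∸ 1
  others≢g = trans (count-not _ (others g)) (cong₂ _∸_ (length-others g) (count-≟-others-self g))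

neighboursAt-differ : ∀ {m q} {g x : Fin q} → g ≢ x → (γ s : Word m q) (e : ℕ) →
  neighboursAt (g ∷ γ) (x ∷ s) e ≡
    𝟙 (hd γ s ≡ᵇ e) + (q ∸ 2) * 𝟙 (suc (hd γ s) ≡ᵇ e) + count (λ δ → suc (hd δ s) ≡ᵇ e) (neighbours γ)
neighboursAt-differ {q = q} {g} {x} g≢x γ s e =
  trans (neighboursAt-∷ g x γ s e)
    (cong₂ _+_ (trans (cong₂ (λ a b → a * 𝟙 (hd γ s ≡ᵇ e) + b * 𝟙 (suc (hd γ s) ≡ᵇ e))
                             (count-≟-others x≢g) others≢x)
                      (cong (_+ (q ∸ 2) * 𝟙 (suc (hd γ s) ≡ᵇ e)) (*-identityˡ (𝟙 (hd γ s ≡ᵇ e)))))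
               (count-cong (λ δ → cong (λ k → k + hd δ s ≡ᵇ e) (mismatch-≢ g≢x)) (neighbours γ)))
  where
  x≢g = g≢x ∘ sym
  others≢x : count (λ a → not ⌊ a ≟ x ⌋) (others g) ≡ q ∸ 2
  others≢x = trans (count-not _ (others g))
    (trans (cong₂ _∸_ (length-others g) (count-≟-others x≢g)) (∸-+-assoc q 1 1))

intersectionNumber-same : ∀ q m d e → d ≤ m →
  (q ∸ 1) * 𝟙 (suc d ≡ᵇ e) + intersectionNumber q m d e ≡ intersectionNumber q (suc m) d e
intersectionNumber-same q m d e d≤m = begin
  Q₁ * Z + (X * d + Y * (d * Q₂) + Z * ((m ∸ d) * Q₁))
    ≡⟨ shape X Y Z d Q₁ Q₂ (m ∸ d) ⟩
  X * d + Y * (d * Q₂) + Z * ((1 + (m ∸ d)) * Q₁)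
    ≡⟨ cong (λ w → X * d + Y * (d * Q₂) + Z * (w * Q₁)) (+-∸-assoc 1 d≤m) ⟨
  X * d + Y * (d * Q₂) + Z * ((suc m ∸ d) * Q₁)
    ∎
  where
  open ≡-Reasoning
  X = 𝟙 (d ≡ᵇ suc e); Y = 𝟙 (d ≡ᵇ e); Z = 𝟙 (suc d ≡ᵇ e); Q₁ = q ∸ 1; Q₂ = q ∸ 2
  shape : ∀ X Y Z d Q₁ Q₂ W →
    Q₁ * Z + (X * d + Y * (d * Q₂) + Z * (W * Q₁)) ≡ X * d + Y * (d * Q₂) + Z * ((1 + W) * Q₁)
  shape = solve-∀

intersectionNumber-differ : ∀ q m d e →
  𝟙 (d ≡ᵇ suc e) + (q ∸ 2) * 𝟙 (d ≡ᵇ e) + intersectionNumber q m d e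
    ≡ intersectionNumber q (suc m) (suc d) (suc e)
intersectionNumber-differ q m d e = shape (𝟙 (d ≡ᵇ suc e)) (𝟙 (d ≡ᵇ e)) (𝟙 (suc d ≡ᵇ e)) d (q ∸ 2) _
  where
  shape : ∀ X Y Z d Q₂ R →
    X + Q₂ * Y + (X * d + Y * (d * Q₂) + Z * R) ≡ X * (1 + d) + Y * ((1 + d) * Q₂) + Z * R
  shape = solve-∀

neighboursAt≡intersectionNumber : ∀ {m q} (γ s : Word m q) (e : ℕ) →
  neighboursAt γ s e ≡ intersectionNumber q m (hd γ s) e
neighboursAt≡intersectionNumber []      []      zero          = refl
neighboursAt≡intersectionNumber []      []      (suc zero)    = refl
neighboursAt≡intersectionNumber []      []      (suc (suc e)) = refl
neighboursAt≡intersectionNumber {suc m} {q} (g ∷ γ) (x ∷ s) e with g ≟ x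
... | yes refl = begin
  neighboursAt (g ∷ γ) (g ∷ s) e
    ≡⟨ neighboursAt-same g γ s e ⟩
  (q ∸ 1) * 𝟙 (suc (hd γ s) ≡ᵇ e) + neighboursAt γ s e
    ≡⟨ cong ((q ∸ 1) * 𝟙 (suc (hd γ s) ≡ᵇ e) +_) (neighboursAt≡intersectionNumber γ s e) ⟩
  (q ∸ 1) * 𝟙 (suc (hd γ s) ≡ᵇ e) + intersectionNumber q m (hd γ s) e
    ≡⟨ intersectionNumber-same q m (hd γ s) e (hd≤m γ s) ⟩
  intersectionNumber q (suc m) (hd γ s) e
    ∎
  where open ≡-Reasoning
... | no g≢x = trans (neighboursAt-differ g≢x γ s e) (differ e)
  where
  open ≡-Reasoning
  d = hd γ s
  differ : ∀ e → 𝟙 (d ≡ᵇ e) + (q ∸ 2) * 𝟙 (suc d ≡ᵇ e) + count (λ δ → suc (hd δ s) ≡ᵇ e) (neighbours γ)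
                 ≡ intersectionNumber q (suc m) (suc d) e
  differ zero = begin
    𝟙 (d ≡ᵇ 0) + (q ∸ 2) * 0 + count (λ _ → false) (neighbours γ)
      ≡⟨ cong₂ (λ a b → 𝟙 (d ≡ᵇ 0) + a + b) (*-zeroʳ (q ∸ 2)) (count-none {xs = neighbours γ} (λ _ → refl)) ⟩
    𝟙 (d ≡ᵇ 0) + 0 + 0
      ≡⟨ nearest-zero d ⟩
    𝟙 (d ≡ᵇ 0) * suc d + 0 + 0 ∎
    where
    nearest-zero : ∀ d → 𝟙 (d ≡ᵇ 0) + 0 + 0 ≡ 𝟙 (d ≡ᵇ 0) * suc d + 0 + 0
    nearest-zero zero    = refl
    nearest-zero (suc _) = refl
  differ (suc e) =
    trans (cong (𝟙 (d ≡ᵇ suc e) + (q ∸ 2) * 𝟙 (d ≡ᵇ e) +_) (neighboursAt≡intersectionNumber γ s e))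
          (intersectionNumber-differ q m d e)

count-hd≡0 : ∀ {m q} (γ : Word m q) → count (λ w → hd γ w ≡ᵇ 0) (words m q) ≡ 1
count-hd≡0 []                    = refl
count-hd≡0 {suc m} {q} (g ∷ γ) = begin
  count P (concatMap (λ a → map (a ∷_) (words m q)) (allFin q))  ≡⟨ count-concatMap P _ (allFin q) ⟩
  ∑ (λ a → count P (map (a ∷_) (words m q))) (allFin q)          ≡⟨ ∑-cong per-letter (allFin q) ⟩
  ∑ (λ a → 𝟙 ⌊ a ≟ g ⌋) (allFin q)                               ≡⟨ count≡∑𝟙 _ (allFin q) ⟨
  count (λ a → ⌊ a ≟ g ⌋) (allFin q)                             ≡⟨ count-≟-allFin g ⟩
  1                                                              ∎
  where
  open ≡-Reasoning
  P = λ w → hd (g ∷ γ) w ≡ᵇ 0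
  per-letter : ∀ a → count P (map (a ∷_) (words m q)) ≡ 𝟙 ⌊ a ≟ g ⌋
  per-letter a with count-map P (a ∷_) (words m q) | a ≟ g
  ... | eq | yes refl =
    trans eq (trans (count-cong (λ w → cong (_≡ᵇ 0) (hd-∷-≡ g γ w)) (words m q)) (count-hd≡0 γ))
  ... | eq | no a≢g   =
    trans eq (trans (count-cong (λ w → cong (_≡ᵇ 0) (hd-∷-≢ (a≢g ∘ sym) γ w)) (words m q))
                    (count-none {xs = words m q} (λ _ → refl)))

countAt-zero : ∀ {m q} (D : Code m q) (γ : Word m q) → countAt D γ 0 ≡ 𝟙 (D γ)
countAt-zero {m} {q} D γ =
  trans (count-filterᵇ _ D (words m q)) (trans (count-cong only-γ (words m q)) (by (D γ)))
  where
  only-γ : ∀ w → (D w ∧ (hd γ w ≡ᵇ 0)) ≡ ((hd γ w ≡ᵇ 0) ∧ D γ)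
  only-γ w with hd γ w ≡ᵇ 0 in γw≡0
  ... | true  = trans (∧-identityʳ (D w)) (cong D (sym (hd≡0⇒≡ γ w (≡ᵇ-sound γw≡0))))
  ... | false = ∧-zeroʳ (D w)
  by : ∀ b → count (λ w → (hd γ w ≡ᵇ 0) ∧ b) (words m q) ≡ 𝟙 b
  by true  = trans (count-cong (λ _ → ∧-identityʳ _) (words m q)) (count-hd≡0 γ)
  by false = trans (count-cong (λ _ → ∧-zeroʳ _) (words m q)) (count-none {xs = words m q} (λ _ → refl))

countAt-big : ∀ {m q} (D : Code m q) (γ : Word m q) (k : ℕ) → m < k → countAt D γ k ≡ 0
countAt-big D γ k m<k =
  count-none {xs = codewords D} (λ {c} _ → ≡ᵇ-false (λ γc≡k → <⇒≱ m<k (subst (_≤ _) γc≡k (hd≤m γ c))))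

-- The number of codewords at distance e − 1 from γ: none for e = 0, where
-- countAt D γ (e ∸ 1) would count those at distance 0.
countAt⁻ : ∀ {m q} → Code m q → Word m q → ℕ → ℕ
countAt⁻ D γ zero    = 0
countAt⁻ D γ (suc e) = countAt D γ e

∑-countAt-neighbours : ∀ {m q} (D : Code m q) (γ : Word m q) (e : ℕ) →
  ∑ (λ δ → countAt D δ e) (neighbours γ) ≡
    countAt D γ (suc e) * suc e
    + (countAt D γ e * (e * (q ∸ 2)) + countAt⁻ D γ e * ((m ∸ pred e) * (q ∸ 1)))
∑-countAt-neighbours {m} {q} D γ e = begin
  ∑ (λ δ → countAt D δ e) (neighbours γ)
    ≡⟨ count-comm (λ δ c → hd δ c ≡ᵇ e) (neighbours γ) cs ⟩
  ∑ (λ c → neighboursAt γ c e) cs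
    ≡⟨ ∑-cong (λ c → neighboursAt≡intersectionNumber γ c e) cs ⟩
  ∑ (λ c → intersectionNumber q m (hd γ c) e) cs
    ≡⟨ trans (∑-distrib-+ (λ c → down c + level c) up cs) (cong (_+ ∑ up cs) (∑-distrib-+ down level cs)) ⟩
  ∑ down cs + ∑ level cs + ∑ up cs
    ≡⟨ cong₂ _+_ (cong₂ _+_ (∑-𝟙≡ᵇ (hd γ) id (suc e) cs) (∑-𝟙≡ᵇ (hd γ) (_* (q ∸ 2)) e cs))
                 (∑-𝟙≡ᵇ (suc ∘ hd γ) (λ n → (m ∸ pred n) * (q ∸ 1)) e cs) ⟩
  countAt D γ (suc e) * suc e + countAt D γ e * (e * (q ∸ 2))
    + count (λ c → suc (hd γ c) ≡ᵇ e) cs * ((m ∸ pred e) * (q ∸ 1))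
    ≡⟨ cong (λ k → countAt D γ (suc e) * suc e + countAt D γ e * (e * (q ∸ 2)) + k * ((m ∸ pred e) * (q ∸ 1)))
            (one-closer e) ⟩
  countAt D γ (suc e) * suc e + countAt D γ e * (e * (q ∸ 2)) + countAt⁻ D γ e * ((m ∸ pred e) * (q ∸ 1))
    ≡⟨ +-assoc (countAt D γ (suc e) * suc e) _ _ ⟩
  _ ∎
  where
  open ≡-Reasoning
  cs = codewords D
  down level up : Word m q → ℕ
  down  c = 𝟙 (hd γ c ≡ᵇ suc e) * hd γ c
  level c = 𝟙 (hd γ c ≡ᵇ e) * (hd γ c * (q ∸ 2))
  up    c = 𝟙 (suc (hd γ c) ≡ᵇ e) * ((m ∸ hd γ c) * (q ∸ 1))
  one-closer : ∀ e → count (λ c → suc (hd γ c) ≡ᵇ e) cs ≡ countAt⁻ D γ e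
  one-closer zero    = count-none {xs = cs} (λ _ → refl)
  one-closer (suc e) = refl

-- Equitable partitions

module _ {m q : ℕ} (κ : Word m q → ℕ) where

  FactorsThrough : (Word m q → ℕ) → Set
  FactorsThrough f = ∀ γ γ′ → κ γ ≡ κ γ′ → f γ ≡ f γ′

  -- For f the indicator of a class of κ this is the usual definition of an
  -- equitable partition.
  Equitable : Set
  Equitable = ∀ f → FactorsThrough f → FactorsThrough (λ γ → ∑ f (neighbours γ))

module _ {m q : ℕ} (κ : Word m q → ℕ) (D : Code m q) (e : ℕ)
         (e-factors  : FactorsThrough κ (λ γ → countAt D γ e))
         (e⁻-factors : FactorsThrough κ (λ γ → countAt⁻ D γ e)) where

  private
    lower : Word m q → ℕ
    lower γ = countAt D γ e * (e * (q ∸ 2)) + countAt⁻ D γ e * ((m ∸ pred e) * (q ∸ 1))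

    lower-factors : FactorsThrough κ lower
    lower-factors γ γ′ eq =
      cong₂ (λ a b → a * (e * (q ∸ 2)) + b * ((m ∸ pred e) * (q ∸ 1))) (e-factors γ γ′ eq) (e⁻-factors γ γ′ eq)

  ∑-countAt-neighbours-factors : FactorsThrough κ (λ γ → countAt D γ (suc e)) →
    FactorsThrough κ (λ γ → ∑ (λ δ → countAt D δ e) (neighbours γ))
  ∑-countAt-neighbours-factors suc-factors γ γ′ eq =
    trans (∑-countAt-neighbours D γ e)
      (trans (cong₂ (λ a b → a * suc e + b) (suc-factors γ γ′ eq) (lower-factors γ γ′ eq))
             (sym (∑-countAt-neighbours D γ′ e)))

  countAt-suc-factors : FactorsThrough κ (λ γ → ∑ (λ δ → countAt D δ e) (neighbours γ)) →
    FactorsThrough κ (λ γ → countAt D γ (suc e))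
  countAt-suc-factors ∑-factors γ γ′ eq = *-cancelʳ-≡ _ _ (suc e) (+-cancelʳ-≡ (lower γ′) _ _ (begin
    countAt D γ (suc e) * suc e + lower γ′   ≡⟨ cong (countAt D γ (suc e) * suc e +_) (lower-factors γ γ′ eq) ⟨
    countAt D γ (suc e) * suc e + lower γ    ≡⟨ ∑-countAt-neighbours D γ e ⟨
    ∑ (λ δ → countAt D δ e) (neighbours γ)   ≡⟨ ∑-factors γ γ′ eq ⟩
    ∑ (λ δ → countAt D δ e) (neighbours γ′)  ≡⟨ ∑-countAt-neighbours D γ′ e ⟩
    countAt D γ′ (suc e) * suc e + lower γ′  ∎))
    where open ≡-Reasoning

module _ {m q : ℕ} (κ : Word m q → ℕ) (D : Code m q) (equitable : Equitable κ)
         (D-factors : FactorsThrough κ (𝟙 ∘ D)) where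

  equitable⇒countAt-factors  : ∀ k → FactorsThrough κ (λ γ → countAt D γ k)
  equitable⇒countAt⁻-factors : ∀ k → FactorsThrough κ (λ γ → countAt⁻ D γ k)

  equitable⇒countAt-factors zero    γ γ′ eq =
    trans (countAt-zero D γ) (trans (D-factors γ γ′ eq) (sym (countAt-zero D γ′)))
  equitable⇒countAt-factors (suc k) =
    countAt-suc-factors κ D k (equitable⇒countAt-factors k) (equitable⇒countAt⁻-factors k)
      (equitable _ (equitable⇒countAt-factors k))

  equitable⇒countAt⁻-factors zero    _ _ _ = refl
  equitable⇒countAt⁻-factors (suc k) = equitable⇒countAt-factors k

-- Completely regular codes

module CompletelyRegularCode {m q : ℕ} (C : Code m q) (ne : NonEmpty C) (cr : CompletelyRegular C)
  where

  dC : Word m q → ℕ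
  dC γ = dist γ C

  ρ : ℕ
  ρ = coveringRadius C

  dC≤ρ : ∀ γ → dC γ ≤ ρ
  dC≤ρ = dist≤coveringRadius C

  countAt-factors : ∀ k → FactorsThrough dC (λ γ → countAt C γ k)
  countAt-factors k γ γ′ eq with k ≤? m
  ... | yes k≤m = cr (dC γ) (dC≤ρ γ) γ γ′ (≡ᵇ-complete {dC γ} refl) (≡ᵇ-complete (sym eq)) k k≤m
  ... | no  k≰m = trans (countAt-big C γ k (≰⇒> k≰m)) (sym (countAt-big C γ′ k (≰⇒> k≰m)))

  countAt⁻-factors : ∀ k → FactorsThrough dC (λ γ → countAt⁻ C γ k)
  countAt⁻-factors zero    _ _ _ = refl
  countAt⁻-factors (suc k) = countAt-factors k

  ∑-countAt-C-neighbours-factors : ∀ k → FactorsThrough dC (λ γ → ∑ (λ δ → countAt C δ k) (neighbours γ))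
  ∑-countAt-C-neighbours-factors k =
    ∑-countAt-neighbours-factors dC C k (countAt-factors k) (countAt⁻-factors k) (countAt-factors (suc k))

  countAt-dist>0 : ∀ δ → 0 < countAt C δ (dC δ)
  countAt-dist>0 δ with nearest C ne δ
  ... | c , c∈C , δc≡dist =
    ∈⇒length>0 (∈-filterᵇ⁺ (λ c → hd δ c ≡ᵇ dC δ) (∈-codewords C c∈C) (≡ᵇ-complete δc≡dist))

  countAt-<dist : ∀ {j δ} → j < dC δ → countAt C δ j ≡ 0
  countAt-<dist {j} {δ} j<dist = count-none (λ {c} c∈ → ≡ᵇ-false (λ δc≡j →
    <⇒≱ j<dist (subst (dC δ ≤_) δc≡j (dist≤hd C δ (∈-codewords⁻ C c∈)))))

  ∑-countAt-<dist : ∀ {j xs} → All (λ δ → j < dC δ) xs → ∑ (λ δ → countAt C δ j) xs ≡ 0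
  ∑-countAt-<dist {xs = xs} j<dists =
    trans (∑-const 0 (All.map (λ {δ} → countAt-<dist {δ = δ}) j<dists)) (*-zeroʳ (length xs))

  dist-step : ∀ {γ δ} → hd γ δ ≡ 1 → dC γ ≤ suc (dC δ)
  dist-step {γ} {δ} γδ≡1 = subst (λ k → dC γ ≤ k + dC δ) γδ≡1 (dist-triangle C ne γ δ)

  below beside above : Word m q → List (Word m q)
  below  γ = filterᵇ (λ δ → dC δ <ᵇ dC γ) (neighbours γ)
  beside γ = filterᵇ (λ δ → dC δ ≡ᵇ dC γ) (neighbours γ)
  above  γ = filterᵇ (λ δ → dC γ <ᵇ dC δ) (neighbours γ)

  below-layer : ∀ γ {i} → dC γ ≡ i → All (λ δ → suc (dC δ) ≡ i) (below γ)
  below-layer γ γ≡i = All-filterᵇ _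
    (λ {δ} δ∈ δ<γ → trans (≤-antisym (<ᵇ-sound δ<γ) (dist-step {γ} {δ} (∈-neighbours⁻ γ δ δ∈))) γ≡i)
    (All.tabulate id)

  beside-layer : ∀ γ {i} → dC γ ≡ i → All (λ δ → dC δ ≡ i) (beside γ)
  beside-layer γ γ≡i = All-filterᵇ _ (λ _ δ≡γ → trans (≡ᵇ-sound δ≡γ) γ≡i) (All.tabulate {xs = neighbours γ} id)

  above-layer : ∀ γ {i} → dC γ ≡ i → All (λ δ → dC δ ≡ suc i) (above γ)
  above-layer γ γ≡i = All-filterᵇ _
    (λ {δ} δ∈ γ<δ →
      trans (≤-antisym (dist-step {δ} {γ} (trans (hd-sym δ γ) (∈-neighbours⁻ γ δ δ∈))) (<ᵇ-sound γ<δ))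
            (cong suc γ≡i))
    (All.tabulate id)

  ∑-neighbours-split : ∀ g γ → ∑ g (neighbours γ) ≡ ∑ g (below γ) + ∑ g (beside γ) + ∑ g (above γ)
  ∑-neighbours-split g γ = ∑-trichotomy dC (dC γ) g (neighbours γ)

  private
    module InLayer (j : ℕ) where
      a : Word m q → ℕ
      a δ = countAt C δ j

      a-const : ∀ x y → dC x ≡ j → dC y ≡ j → a x ≡ a y
      a-const x y x≡j y≡j = countAt-factors j x y (trans x≡j (sym y≡j))

      a-pos : ∀ x → dC x ≡ j → 0 < a x
      a-pos x x≡j = subst (λ k → 0 < countAt C x k) x≡j (countAt-dist>0 x)

  length-below-factors : FactorsThrough dC (length ∘ below)
  length-below-factors γ γ′ eq = by-layer (dC γ) refl (sym eq)
    where
    by-layer : ∀ i → dC γ ≡ i → dC γ′ ≡ i → length (below γ) ≡ length (below γ′)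
    by-layer zero    γ≡0 γ′≡0 = trans (empty γ γ≡0) (sym (empty γ′ γ′≡0))
      where
      empty : ∀ γ → dC γ ≡ 0 → length (below γ) ≡ 0
      empty γ γ≡0 = count-none {xs = neighbours γ} (λ {δ} _ → cong (dC δ <ᵇ_) γ≡0)
    by-layer (suc j) γ≡ γ′≡ =
      ∑≡⇒length≡ {P = λ δ → dC δ ≡ j} {g = a} a-const a-pos (below-in γ γ≡) (below-in γ′ γ′≡)
        (trans (sym (only-below γ γ≡)) (trans (∑-countAt-C-neighbours-factors j γ γ′ (trans γ≡ (sym γ′≡)))
                                            (only-below γ′ γ′≡)))
      where
      open InLayer j
      below-in : ∀ γ → dC γ ≡ suc j → All (λ δ → dC δ ≡ j) (below γ)
      below-in γ γ≡ = All.map suc-injective (below-layer γ γ≡)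
      only-below : ∀ γ → dC γ ≡ suc j → ∑ a (neighbours γ) ≡ ∑ a (below γ)
      only-below γ γ≡ = begin
        ∑ a (neighbours γ)                                 ≡⟨ ∑-neighbours-split a γ ⟩
        ∑ a (below γ) + ∑ a (beside γ) + ∑ a (above γ)     ≡⟨ cong₂ (λ x y → ∑ a (below γ) + x + y)
             (∑-countAt-<dist (All.map (λ δ≡ → ≤-reflexive (sym δ≡)) (beside-layer γ γ≡)))
             (∑-countAt-<dist (All.map (λ δ≡ → ≤-trans (n≤1+n _) (≤-reflexive (sym δ≡))) (above-layer γ γ≡))) ⟩
        ∑ a (below γ) + 0 + 0                              ≡⟨ trans (+-identityʳ _) (+-identityʳ _) ⟩
        ∑ a (below γ)                                      ∎
        where open ≡-Reasoning

  length-beside-factors : FactorsThrough dC (length ∘ beside)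
  length-beside-factors γ γ′ eq =
    ∑≡⇒length≡ {P = λ δ → dC δ ≡ i} {g = a} a-const a-pos (beside-layer γ refl) (beside-layer γ′ (sym eq))
      (+-cancelˡ-≡ (∑ a (below γ)) _ _ (begin
        ∑ a (below γ) + ∑ a (beside γ)     ≡⟨ below+beside γ refl ⟨
        ∑ a (neighbours γ)                 ≡⟨ ∑-countAt-C-neighbours-factors i γ γ′ eq ⟩
        ∑ a (neighbours γ′)                ≡⟨ below+beside γ′ (sym eq) ⟩
        ∑ a (below γ′) + ∑ a (beside γ′)   ≡⟨ cong (_+ ∑ a (beside γ′)) below-sums ⟨
        ∑ a (below γ) + ∑ a (beside γ′)    ∎))
    where
    open ≡-Reasoning
    i = dC γ
    open InLayer i
    below-sums : ∑ a (below γ) ≡ ∑ a (below γ′)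
    below-sums = length≡⇒∑≡ {g = a} (λ x y px py → countAt-factors i x y (suc-injective (trans px (sym py))))
      (below-layer γ refl) (below-layer γ′ (sym eq)) (length-below-factors γ γ′ eq)
    below+beside : ∀ γ → dC γ ≡ i → ∑ a (neighbours γ) ≡ ∑ a (below γ) + ∑ a (beside γ)
    below+beside γ γ≡ = begin
      ∑ a (neighbours γ)                              ≡⟨ ∑-neighbours-split a γ ⟩
      ∑ a (below γ) + ∑ a (beside γ) + ∑ a (above γ)  ≡⟨ cong (∑ a (below γ) + ∑ a (beside γ) +_)
           (∑-countAt-<dist (All.map (λ δ≡ → ≤-reflexive (sym δ≡)) (above-layer γ γ≡))) ⟩
      ∑ a (below γ) + ∑ a (beside γ) + 0              ≡⟨ +-identityʳ _ ⟩
      ∑ a (below γ) + ∑ a (beside γ)                  ∎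

  length-above-factors : FactorsThrough dC (length ∘ above)
  length-above-factors γ γ′ eq = +-cancelˡ-≡ (length (below γ) + length (beside γ)) _ _ (begin
    length (below γ) + length (beside γ) + length (above γ)
      ≡⟨ lengths-split γ ⟨
    length (neighbours γ)
      ≡⟨ trans (length-neighbours γ) (sym (length-neighbours γ′)) ⟩
    length (neighbours γ′)
      ≡⟨ lengths-split γ′ ⟩
    length (below γ′) + length (beside γ′) + length (above γ′)
      ≡⟨ cong₂ (λ x y → x + y + length (above γ′)) (length-below-factors γ γ′ eq)
                                                   (length-beside-factors γ γ′ eq) ⟨
    length (below γ) + length (beside γ) + length (above γ′)
      ∎)
    where
    open ≡-Reasoning
    lengths-split : ∀ γ → length (neighbours γ) ≡ length (below γ) + length (beside γ) + length (above γ)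
    lengths-split γ = trans (length≡∑1 (neighbours γ)) (trans (∑-neighbours-split (λ _ → 1) γ)
      (sym (cong₂ _+_ (cong₂ _+_ (length≡∑1 (below γ)) (length≡∑1 (beside γ))) (length≡∑1 (above γ)))))

  equitable : Equitable dC
  equitable f f-factors γ γ′ eq = begin
    ∑ f (neighbours γ)                                  ≡⟨ ∑-neighbours-split f γ ⟩
    ∑ f (below γ) + ∑ f (beside γ) + ∑ f (above γ)      ≡⟨ cong₂ _+_ (cong₂ _+_
      (length≡⇒∑≡ (λ x y px py → f-factors x y (suc-injective (trans px (sym py))))
                  (below-layer γ refl) (below-layer γ′ (sym eq)) (length-below-factors γ γ′ eq))
      (length≡⇒∑≡ (λ x y px py → f-factors x y (trans px (sym py)))
                  (beside-layer γ refl) (beside-layer γ′ (sym eq)) (length-beside-factors γ γ′ eq)))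
      (length≡⇒∑≡ (λ x y px py → f-factors x y (trans px (sym py)))
                  (above-layer γ refl) (above-layer γ′ (sym eq)) (length-above-factors γ γ′ eq)) ⟩
    ∑ f (below γ′) + ∑ f (beside γ′) + ∑ f (above γ′)   ≡⟨ ∑-neighbours-split f γ′ ⟨
    ∑ f (neighbours γ′)                                 ∎
    where open ≡-Reasoning

  -- On a geodesic from a nearest codeword c to a vertex w of C_ρ, the vertices
  -- at distance i and i + 1 from c lie in C_i and C_{i+1}.
  exists-above : ∀ i → i < ρ → ∃ λ u → dC u ≡ i × 0 < length (above u)
  exists-above i i<ρ with coveringRadius-attained C ne
  ... | w , w≡ρ with nearest C ne w
  ... | c , c∈C , wc≡dist
    with geodesic c w (suc i) (subst (suc i ≤_) (sym (trans (hd-sym c w) (trans wc≡dist w≡ρ))) i<ρ)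
  ... | u′ , cu′≡ , on-cw with geodesic c u′ i (subst (i ≤_) (sym cu′≡) (n≤1+n i))
  ... | u  , cu≡  , on-cu′ =
    u , u≡i , ∈⇒length>0 (∈-filterᵇ⁺ (λ δ → dC u <ᵇ dC δ) (∈-neighbours⁺ u u′ uu′≡1)
                                    (<ᵇ-complete (subst₂ _<_ (sym u≡i) (sym u′≡) (n<1+n i))))
    where
    u′≡ : dC u′ ≡ suc i
    u′≡ = trans (dist-geodesic C c∈C wc≡dist (subst (λ k → k + hd u′ w ≡ hd c w) (sym cu′≡) on-cw)) cu′≡
    u≡i : dC u ≡ i
    u≡i = trans (dist-geodesic C c∈C (trans (hd-sym u′ c) (trans cu′≡ (sym u′≡)))
                               (subst (λ k → k + hd u u′ ≡ hd c u′) (sym cu≡) on-cu′)) cu≡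
    uu′≡1 : hd u u′ ≡ 1
    uu′≡1 = +-cancelˡ-≡ i (hd u u′) 1 (trans on-cu′ (trans cu′≡ (+-comm 1 i)))

  -- Opaque: only the existence of δ is used, and unfolding this proof during
  -- the conversion checks in path-to-Cρ exhausts memory.
  opaque
    above-nonempty : ∀ γ → dC γ < ρ → ∃ λ δ → δ ∈ neighbours γ × dC δ ≡ suc (dC γ)
    above-nonempty γ γ<ρ =
      let u , u≡γ , above-u>0 = exists-above (dC γ) γ<ρ
          δ , δ∈above = length>0⇒∈ {xs = above γ} (subst (0 <_) (length-above-factors u γ u≡γ) above-u>0)
      in δ , proj₁ (∈-filterᵇ⁻ (λ δ → dC γ <ᵇ dC δ) {xs = neighbours γ} δ∈above)
           , All.lookup (above-layer γ refl) δ∈above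

  Cρ : Code m q
  Cρ = layer C ρ

  path-to-Cρ : ∀ n γ → dC γ + n ≡ ρ → ∃ λ t → t ∈C Cρ × hd γ t ≤ n
  path-to-Cρ zero    γ γ+0≡ρ =
    γ , ≡ᵇ-complete {dC γ} {ρ} (trans (sym (+-identityʳ (dC γ))) γ+0≡ρ) , ≤-reflexive (hd-refl γ)
  path-to-Cρ (suc n) γ γ+n≡ρ =
    let δ , δ∈neighbours , δ≡ = above-nonempty γ (subst (dC γ <_) γ+n≡ρ (m<m+n (dC γ) z<s))
        t , t∈Cρ , δt≤n = path-to-Cρ n δ (trans (cong (_+ n) δ≡) (trans (sym (+-suc (dC γ) n)) γ+n≡ρ))
    in t , t∈Cρ , ≤-trans (hd-triangle γ δ t) (+-mono-≤ (≤-reflexive (∈-neighbours⁻ γ δ δ∈neighbours)) δt≤n)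

  dist-Cρ : ∀ γ → dist γ Cρ ≡ ρ ∸ dC γ
  dist-Cρ γ with path-to-Cρ (ρ ∸ dC γ) γ (m+[n∸m]≡n (dC≤ρ γ))
  ... | t , t∈Cρ , γt≤ = ≤-antisym (≤-trans (dist≤hd Cρ γ t∈Cρ) γt≤)
    (dist-glb Cρ γ (≤-trans (m∸n≤m ρ (dC γ)) (coveringRadius-lub C (dist≤m C ne)))
      (λ t t∈Cρ → m≤n+o⇒m∸n≤o ρ (dC γ) (begin
        ρ                  ≡⟨ ≡ᵇ-sound t∈Cρ ⟨
        dC t               ≤⟨ dist-triangle C ne t γ ⟩
        hd t γ + dC γ      ≡⟨ trans (+-comm (hd t γ) _) (cong (dC γ +_) (hd-sym t γ)) ⟩
        dC γ + hd γ t      ∎)))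
    where open ≤-Reasoning

  layer-Cρ : ∀ i → i ≤ ρ → ∀ γ → layer Cρ i γ ≡ layer C (ρ ∸ i) γ
  layer-Cρ i i≤ρ γ = ≡ᵇ-cong (mk⇔
    (λ γ≡i → trans (sym (m∸[m∸n]≡n (dC≤ρ γ))) (cong (ρ ∸_) (trans (sym (dist-Cρ γ)) γ≡i)))
    (λ γ≡ρ-i → trans (dist-Cρ γ) (trans (cong (ρ ∸_) γ≡ρ-i) (m∸[m∸n]≡n i≤ρ))))

  layer-Cρ-ρ : ∀ γ → layer Cρ ρ γ ≡ C γ
  layer-Cρ-ρ γ = trans (layer-Cρ ρ ≤-refl γ) (trans (cong (λ j → layer C j γ) (n∸n≡0 ρ)) (layer-zero C ne γ))

  coveringRadius-Cρ : coveringRadius Cρ ≡ ρ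
  coveringRadius-Cρ = ≤-antisym
    (coveringRadius-lub Cρ (λ γ → subst (_≤ ρ) (sym (dist-Cρ γ)) (m∸n≤m ρ (dC γ))))
    (subst (_≤ coveringRadius Cρ) (trans (dist-Cρ c) (cong (ρ ∸_) (∈⇒dist≡0 C c∈C))) (dist≤coveringRadius Cρ c))
    where
    c = proj₁ ne
    c∈C = proj₂ ne

  completelyRegular-Cρ : CompletelyRegular Cρ
  completelyRegular-Cρ i _ γ γ′ γ∈ γ′∈ k _ =
    equitable⇒countAt-factors dC Cρ equitable (λ _ _ eq → cong (λ d → 𝟙 (d ≡ᵇ ρ)) eq) k γ γ′
      (∸-cancelˡ-≡ (dC≤ρ γ) (dC≤ρ γ′)
        (trans (sym (dist-Cρ γ)) (trans (≡ᵇ-sound γ∈) (trans (sym (≡ᵇ-sound γ′∈)) (dist-Cρ γ′)))))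

  stabilises-C⇔Cρ : ∀ g → Stabilises g C ⇔ Stabilises g Cρ
  stabilises-C⇔Cρ g with coveringRadius-attained C ne
  ... | w , w≡ρ = mk⇔ (λ g-stab → stabilises-layer g C ne g-stab ρ) (λ g-stab x →
    trans (sym (layer-Cρ-ρ (fun g x)))
          (trans (stabilises-layer g Cρ (w , ≡ᵇ-complete w≡ρ) g-stab ρ x) (layer-Cρ-ρ x)))

  completelyTransitive-C⇔Cρ : ∀ X → CompletelyTransitive X C ⇔ CompletelyTransitive X Cρ
  completelyTransitive-C⇔Cρ X = mk⇔
    (λ C-trans i i≤ → IsOrbit-cong X (λ δ → sym (layer-Cρ i (subst (i ≤_) coveringRadius-Cρ i≤) δ))
                                     (C-trans (ρ ∸ i) (m∸n≤m ρ i)))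
    (λ Cρ-trans i i≤ρ → IsOrbit-cong X
       (λ δ → trans (layer-Cρ (ρ ∸ i) (m∸n≤m ρ i) δ) (cong (λ j → layer C j δ) (m∸[m∸n]≡n i≤ρ)))
       (Cρ-trans (ρ ∸ i) (subst (ρ ∸ i ≤_) (sym coveringRadius-Cρ) (m∸n≤m ρ i))))

lemma2p5 : ∀ {m q : ℕ} (C : Code m q) → NonEmpty C → CompletelyRegular C →
    let ρ = coveringRadius C
        Cρ = layer C ρ
    in (CompletelyRegular Cρ
        × coveringRadius Cρ ≡ ρ
        × (∀ i → i ≤ ρ → ∀ γ → layer Cρ i γ ≡ layer C (ρ ∸ i) γ))
       × (∀ (g : Aut m q) → Stabilises g C ⇔ Stabilises g Cρ)
       × (∀ (X : Aut m q → Set) → IsAutGroup X →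
            CompletelyTransitive X C ⇔ CompletelyTransitive X Cρ)
lemma2p5 C ne cr =
  (completelyRegular-Cρ , coveringRadius-Cρ , layer-Cρ) , stabilises-C⇔Cρ ,
  λ X _ → completelyTransitive-C⇔Cρ X
  where open CompletelyRegularCode C ne cr
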